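{- Let $r \ge 2$ and $\delta \in [1/2, 1)$. Every $r$-edge-coloured graph $G$ with $\delta(G) \ge (1-\delta)|V(G)|$ satisfies \[ tc(G) \le \frac{2r^2}{\log(1/\delta)}. \]
   Context: An $r$-edge-coloured graph is a simple graph with a colouring of its edges by $[r]$; $\delta(G)$ is its minimum (uncoloured) degree. A monochromatic tree is a tree subgraph with all edges of one colour (single vertices allowed), and $tc(G)$ is the minimum number of monochromatic trees (not necessarily disjoint) whose vertex sets cover $V(G)$. Logarithms are natural.
   Formalization: The parameter δ ranges over the rational numbers in $[1/2, 1)$. -}

module Defs where

open import Data.Nat using (ℕ; zero; suc)
import Data.Nat as ℕ
open import Data.Bool using (Bool; true; false; if_then_else_)
open import Data.Fin using (Fin)
open import Data.List using (List; []; _∷_; length; map; allFin)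
open import Data.Nat.ListAction using (sum)
open import Data.List.Membership.Propositional using (_∈_)
open import Data.List.Relation.Unary.Unique.Propositional using (Unique)
open import Data.Product using (Σ; ∃; _×_; _,_)
open import Data.Sum using (_⊎_)
open import Data.Integer using (+_)
open import Data.Rational using (ℚ; _/_; _+_; _-_; _*_; _≤_; 0ℚ; 1ℚ)
open import Relation.Binary.PropositionalEquality using (_≡_)
open import Relation.Nullary using (¬_)

record ColouredGraph (n r : ℕ) : Set where
  field
    adj     : Fin n → Fin n → Bool
    adj-sym : ∀ u v → adj u v ≡ adj v u
    irrefl  : ∀ v → adj v v ≡ false
    colour  : Fin n → Fin n → Fin r          -- only meaningful on edges
    col-sym : ∀ u v → colour u v ≡ colour v u

module _ {n r : ℕ} (G : ColouredGraph n r) where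
  open ColouredGraph G

  degree : Fin n → ℕ
  degree v = sum (map (λ u → if adj v u then 1 else 0) (allFin n))

  -- A subgraph H = (vs, es) of G; es is a list of (oriented) edges,
  -- read as the symmetric relation it induces.

  HEdge : List (Fin n × Fin n) → Fin n → Fin n → Set
  HEdge es u v = ((u , v) ∈ es) ⊎ ((v , u) ∈ es)

  data Walk (es : List (Fin n × Fin n)) : Fin n → Fin n → Set where
    here : ∀ {u} → Walk es u u
    step : ∀ {u v w} → HEdge es u v → Walk es v w → Walk es u w

  Consecutive : List (Fin n × Fin n) → List (Fin n) → Set
  Consecutive es [] = Data.Unit.⊤ where import Data.Unit
  Consecutive es (x ∷ []) = Data.Unit.⊤ where import Data.Unit
  Consecutive es (x ∷ y ∷ xs) = HEdge es x y × Consecutive es (y ∷ xs)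

  -- a cycle in H: distinct vertices x₀ … x_{m-1}, m ≥ 3, consecutive ones
  -- adjacent and x_{m-1} adjacent to x₀
  Cycle : List (Fin n × Fin n) → Set
  Cycle es = Σ (Fin n) λ x₀ → Σ (List (Fin n)) λ xs → Σ (Fin n) λ xl →
    let cyc = x₀ ∷ xs Data.List.++ (xl ∷ []) in
    (2 ℕ.≤ length (xs Data.List.++ (xl ∷ []))) × Unique cyc × Consecutive es cyc × HEdge es xl x₀

  -- a monochromatic tree of colour k in G: a connected acyclic subgraph
  -- (nonempty vertex set; single vertices allowed) all of whose edges are
  -- edges of G of colour k
  record MonoTree (k : Fin r) : Set where
    field
      vs        : List (Fin n)
      es        : List (Fin n × Fin n)
      nonempty  : 1 ℕ.≤ length vs
      distinct  : Unique vs
      edge-in-G : ∀ {u v} → (u , v) ∈ es → u ∈ vs × v ∈ vs × adj u v ≡ true × colour u v ≡ k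
      connected : ∀ {u v} → u ∈ vs → v ∈ vs → Walk es u v
      acyclic   : ¬ Cycle es

  TreeCover : ℕ → Set
  TreeCover t = Σ (Fin t → Σ (Fin r) MonoTree) λ T →
    ∀ v → ∃ λ i → v ∈ MonoTree.vs (Data.Product.proj₂ (T i))

fromℕ : ℕ → ℚ
fromℕ m = (+ m) / 1

infixr 8 _^ℚ_
_^ℚ_ : ℚ → ℕ → ℚ
x ^ℚ zero = 1ℚ
x ^ℚ suc k = x * (x ^ℚ k)

-- N-th partial sum of the Mercator series for log(1/δ) = -log(1 - (1-δ)):
--   logInvPartial δ N = Σ_{k=1}^{N} (1-δ)^k / k
logInvPartial : ℚ → ℕ → ℚ
logInvPartial δ zero = 0ℚ
logInvPartial δ (suc N) = logInvPartial δ N + ((1ℚ - δ) ^ℚ suc N) * ((+ 1) / suc N)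

-- "t ≤ c / log(1/δ)", i.e. t · log(1/δ) ≤ c, with log(1/δ) the (increasing,
-- convergent for 0 < δ < 2) sum of the series above: every partial sum bound.
LeDivLogInv : ℕ → ℚ → ℚ → Set
LeDivLogInv t c δ = ∀ N → fromℕ t * logInvPartial δ N ≤ c

{-# OPTIONS --safe #-}
module Submission where

-- Scan the vertices, making each vertex not yet covered a new root v and taking, for every colour c,
-- a spanning tree of the colour-c component of v; these r·|R| trees cover V(G). A later root lies
-- outside every component of an earlier one and components of one colour are equal or disjoint, so
-- the pairs (c, x) with x in the colour-c component of a root are distinct: at most r·n of them.
-- Each neighbour u of a root v yields the pair (colour vu, u), so a root accounts for at least
-- δ(G) ≥ (1-δ)n pairs. Hence |R|(1-δ) ≤ r, the cover has t = r|R| trees with t(1-δ) ≤ r², and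
-- log(1/δ) = Σₖ (1-δ)ᵏ/k ≤ 2(1-δ) once δ ≥ 1/2.

open import Defs

module Arithmetic where

  open import Data.Nat as ℕ using (ℕ; zero; suc)
  import Data.Nat.Properties as ℕ
  open import Data.Nat.Coprimality as Coprime using (1-coprimeTo)
  open import Data.Nat.ListAction using (sum)
  open import Data.Integer as ℤ using (+_)
  import Data.Integer.Properties as ℤ
  open import Data.List using ([]; _∷_; length; map)
  open import Data.Rational
    using (ℚ; mkℚ; ½; 0ℚ; 1ℚ; _+_; _-_; _*_; _/_; _≤_; *≤*; NonNegative; Positive; nonNegative)
  open import Data.Rational.Properties
  open import Data.Rational.Solver using (module +-*-Solver)
  open import Relation.Binary.PropositionalEquality

  fromℕ≡mkℚ : ∀ m → fromℕ m ≡ mkℚ (+ m) 0 (Coprime.sym (1-coprimeTo m))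
  fromℕ≡mkℚ m = normalize-coprime (Coprime.sym (1-coprimeTo m))

  fromℕ-+ : ∀ m n → fromℕ (m ℕ.+ n) ≡ fromℕ m + fromℕ n
  fromℕ-+ m n = begin
    + (m ℕ.+ n) / 1
      ≡⟨ /-cong (cong₂ ℤ._+_ (sym (ℤ.*-identityʳ (+ m))) (sym (ℤ.*-identityʳ (+ n)))) refl ⟩
    (+ m ℤ.* + 1 ℤ.+ + n ℤ.* + 1) / 1
      ≡⟨ sym (cong₂ _+_ (fromℕ≡mkℚ m) (fromℕ≡mkℚ n)) ⟩
    fromℕ m + fromℕ n
      ∎
    where open ≡-Reasoning

  fromℕ-* : ∀ m n → fromℕ (m ℕ.* n) ≡ fromℕ m * fromℕ n
  fromℕ-* m n = trans (/-cong {+ (m ℕ.* n)} {1} {+ m ℤ.* + n} {1} (ℤ.pos-* m n) refl)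
                      (sym (cong₂ _*_ (fromℕ≡mkℚ m) (fromℕ≡mkℚ n)))

  fromℕ-mono-≤ : ∀ {m n} → m ℕ.≤ n → fromℕ m ≤ fromℕ n
  fromℕ-mono-≤ {m} {n} m≤n rewrite fromℕ≡mkℚ m | fromℕ≡mkℚ n =
    *≤* (subst₂ ℤ._≤_ (sym (ℤ.*-identityʳ (+ m))) (sym (ℤ.*-identityʳ (+ n))) (ℤ.+≤+ m≤n))

  fromℕ-nonNeg : ∀ m → NonNegative (fromℕ m)
  fromℕ-nonNeg m = nonNegative (fromℕ-mono-≤ {0} {m} ℕ.z≤n)

  module _ {δ : ℚ} (½≤δ : ½ ≤ δ) (δ≤1 : δ ≤ 1ℚ) where
    private
      ε : ℚ
      ε = 1ℚ - δ

      0≤ε : 0ℚ ≤ ε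
      0≤ε = subst (_≤ ε) (+-inverseʳ 1ℚ) (+-monoʳ-≤ 1ℚ (neg-antimono-≤ δ≤1))

      ε+ε≤1 : ε + ε ≤ 1ℚ
      ε+ε≤1 = +-mono-≤ ε≤½ ε≤½
        where
        ε≤½ : ε ≤ ½
        ε≤½ = +-monoʳ-≤ 1ℚ (neg-antimono-≤ ½≤δ)

      ε^-nonNeg : ∀ k → NonNegative (ε ^ℚ k)
      ε^-nonNeg zero    = _
      ε^-nonNeg (suc k) = nonNeg*nonNeg⇒nonNeg ε {{nonNegative 0≤ε}} (ε ^ℚ k) {{ε^-nonNeg k}}

      1/suc≤1 : ∀ N → + 1 / suc N ≤ 1ℚ
      1/suc≤1 N = subst (_≤ 1ℚ) (sym (normalize-coprime (1-coprimeTo (suc N)))) (*≤* (ℤ.+≤+ (ℕ.s≤s ℕ.z≤n)))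

    -- The slack 2εᴺ⁺¹ covers both the next term εᴺ⁺¹/(N+1) ≤ εᴺ⁺¹ and the next slack 2ε·εᴺ⁺¹ ≤ εᴺ⁺¹.
    logInvPartial+slack≤ε+ε : ∀ N → logInvPartial δ N + (ε ^ℚ suc N + ε ^ℚ suc N) ≤ ε + ε
    logInvPartial+slack≤ε+ε zero = ≤-reflexive (solve 1 (λ x → con 0ℚ :+ (x :* con 1ℚ :+ x :* con 1ℚ) := x :+ x) refl ε)
      where open +-*-Solver
    logInvPartial+slack≤ε+ε (suc N) = begin
      P + e * h + (ε * e + ε * e)
        ≡⟨ solve 4 (λ P e h x → P :+ e :* h :+ (x :* e :+ x :* e) := P :+ (e :* h :+ (x :+ x) :* e)) refl P e h ε ⟩
      P + (e * h + (ε + ε) * e)     ≤⟨ +-monoʳ-≤ P (+-mono-≤ eh≤e 2εe≤e) ⟩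
      P + (e + e)                   ≤⟨ logInvPartial+slack≤ε+ε N ⟩
      ε + ε                         ∎
      where
      open ≤-Reasoning
      open +-*-Solver
      P e h : ℚ
      P = logInvPartial δ N
      e = ε ^ℚ suc N
      h = + 1 / suc N
      instance
        e-nonNeg : NonNegative e
        e-nonNeg = ε^-nonNeg (suc N)
      eh≤e : e * h ≤ e
      eh≤e = subst (e * h ≤_) (*-identityʳ e) (*-monoˡ-≤-nonNeg e (1/suc≤1 N))
      2εe≤e : (ε + ε) * e ≤ e
      2εe≤e = subst ((ε + ε) * e ≤_) (*-identityˡ e) (*-monoʳ-≤-nonNeg e ε+ε≤1)

    logInvPartial≤ε+ε : ∀ N → logInvPartial δ N ≤ ε + ε
    logInvPartial≤ε+ε N =
      ≤-trans (subst (_≤ P + (e + e)) (+-identityʳ P) (+-monoʳ-≤ P 0≤e+e)) (logInvPartial+slack≤ε+ε N)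
      where
      P e : ℚ
      P = logInvPartial δ N
      e = ε ^ℚ suc N
      instance
        e-nonNeg : NonNegative e
        e-nonNeg = ε^-nonNeg (suc N)
      0≤e+e : 0ℚ ≤ e + e
      0≤e+e = nonNegative⁻¹ (e + e) {{nonNeg+nonNeg⇒nonNeg e e}}

    LeDivLogInv-intro : ∀ {t m} → fromℕ t * ε ≤ fromℕ m → LeDivLogInv t (fromℕ (2 ℕ.* m)) δ
    LeDivLogInv-intro {t} {m} tε≤m N = begin
      fromℕ t * logInvPartial δ N  ≤⟨ *-monoˡ-≤-nonNeg (fromℕ t) {{fromℕ-nonNeg t}} (logInvPartial≤ε+ε N) ⟩
      fromℕ t * (ε + ε)            ≡⟨ *-distribˡ-+ (fromℕ t) ε ε ⟩
      fromℕ t * ε + fromℕ t * ε    ≤⟨ +-mono-≤ tε≤m tε≤m ⟩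
      fromℕ m + fromℕ m            ≡⟨ sym (fromℕ-+ m m) ⟩
      fromℕ (m ℕ.+ m)              ≡⟨ cong (λ k → fromℕ (m ℕ.+ k)) (sym (ℕ.+-identityʳ m)) ⟩
      fromℕ (2 ℕ.* m)              ∎
      where open ≤-Reasoning

  length*≤sum : ∀ {A : Set} (f : A → ℕ) {x} → (∀ a → x ≤ fromℕ (f a)) →
                ∀ as → fromℕ (length as) * x ≤ fromℕ (sum (map f as))
  length*≤sum f {x} x≤f []       = ≤-reflexive (*-zeroˡ x)
  length*≤sum f {x} x≤f (a ∷ as) = begin
    fromℕ (1 ℕ.+ length as) * x                ≡⟨ cong (_* x) (fromℕ-+ 1 (length as)) ⟩
    (1ℚ + fromℕ (length as)) * x               ≡⟨ *-distribʳ-+ x 1ℚ (fromℕ (length as)) ⟩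
    1ℚ * x + fromℕ (length as) * x             ≡⟨ cong (_+ fromℕ (length as) * x) (*-identityˡ x) ⟩
    x + fromℕ (length as) * x                  ≤⟨ +-mono-≤ (x≤f a) (length*≤sum f x≤f as) ⟩
    fromℕ (f a) + fromℕ (sum (map f as))       ≡⟨ sym (fromℕ-+ (f a) (sum (map f as))) ⟩
    fromℕ (f a ℕ.+ sum (map f as))             ∎
    where open ≤-Reasoning

  *-cancelʳ-fromℕ-suc : ∀ {a b n x} → fromℕ a * (x * fromℕ (suc n)) ≤ fromℕ (b ℕ.* suc n) → fromℕ a * x ≤ fromℕ b
  *-cancelʳ-fromℕ-suc {a} {b} {n} {x} ≤bn =
    *-cancelʳ-≤-pos (fromℕ (suc n)) {{positive}}
      (subst₂ _≤_ (sym (*-assoc (fromℕ a) x (fromℕ (suc n)))) (fromℕ-* b (suc n)) ≤bn)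
    where
    positive : Positive (fromℕ (suc n))
    positive rewrite fromℕ≡mkℚ (suc n) = _

  *-scaleˡ-fromℕ : ∀ {a b x} c → fromℕ a * x ≤ fromℕ b → fromℕ (c ℕ.* a) * x ≤ fromℕ (c ℕ.* b)
  *-scaleˡ-fromℕ {a} {b} {x} c ax≤b = begin
    fromℕ (c ℕ.* a) * x        ≡⟨ cong (_* x) (fromℕ-* c a) ⟩
    fromℕ c * fromℕ a * x      ≡⟨ *-assoc (fromℕ c) (fromℕ a) x ⟩
    fromℕ c * (fromℕ a * x)    ≤⟨ *-monoˡ-≤-nonNeg (fromℕ c) {{fromℕ-nonNeg c}} ax≤b ⟩
    fromℕ c * fromℕ b          ≡⟨ sym (fromℕ-* c b) ⟩
    fromℕ (c ℕ.* b)            ∎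
    where open ≤-Reasoning

module Components where

  open import Data.Nat as ℕ using (ℕ; zero; suc; _≤_; z≤n; s≤s)
  import Data.Nat.Properties as ℕ
  open import Data.Bool as Bool using (Bool; true; false; if_then_else_)
  open import Data.Bool.Properties using (T-≡)
  open import Function.Bundles using (module Equivalence)
  open import Data.Fin using (Fin; combine; remQuot)
  open import Data.Fin.Properties using (combine-injective; combine-injectiveˡ; combine-injectiveʳ; remQuot-combine)
  import Data.Fin.Properties as Fin
  open import Data.List using (List; []; _∷_; _++_; [_]; length; map; concatMap; filterᵇ; allFin; lookup)
  open import Data.Nat.ListAction using (sum)
  open import Data.List.Properties using (length-++; length-map; length-tabulate)
  open import Data.List.Membership.Propositional using (_∈_; _∉_; find)
  open import Data.List.Membership.Propositional.Properties
    using (∈-∃++; ∈-++⁺ˡ; ∈-++⁺ʳ; ∈-++⁻; ∈-allFin; ∈-map⁺; ∈-map⁻; ∈-concatMap⁺; ∈-concatMap⁻; ∈-filter⁻)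
  open import Data.List.Relation.Unary.Any as Any using (Any; here; there)
  open import Data.List.Relation.Unary.Any.Properties using (lookup-index)
  open import Data.List.Relation.Unary.All as All using ([]; _∷_)
  import Data.List.Relation.Unary.All.Properties as All
  open import Data.List.Relation.Unary.All.Properties using (¬Any⇒All¬)
  import Data.List.Relation.Unary.AllPairs as AllPairs
  import Data.List.Relation.Unary.AllPairs.Properties as AllPairs
  open import Data.List.Relation.Unary.Unique.Propositional.Properties using (map⁺; concat⁺; filter⁺; allFin⁺)
  open import Data.List.Relation.Unary.AllPairs using (AllPairs; []; _∷_)
  open import Data.List.Relation.Binary.Disjoint.Propositional using (Disjoint)
  open import Data.List.Relation.Unary.Unique.Propositional using (Unique)
  open import Data.Product using (Σ; ∃; ∃₂; _×_; _,_; proj₁; proj₂)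
  open import Data.Sum using (_⊎_; inj₁; inj₂)
  open import Data.Unit using (tt)
  open import Data.Empty using (⊥-elim)
  open import Relation.Nullary using (¬_; Dec; yes; no; ¬?; _×-dec_; T?)
  open import Relation.Binary.PropositionalEquality using (_≡_; _≢_; refl; sym; trans; cong; subst; module ≡-Reasoning)
  open import Function using (_∘_)

  length-mono-⊆-Unique : ∀ {A : Set} {xs ys : List A} → Unique xs → (∀ {x} → x ∈ xs → x ∈ ys) → length xs ≤ length ys
  length-mono-⊆-Unique {xs = []}     _              _   = z≤n
  length-mono-⊆-Unique {xs = x ∷ xs} (x∉xs ∷ uniq) xs⊆ys with ys₁ , ys₂ , refl ← ∈-∃++ (xs⊆ys (here refl)) =
    subst (suc (length xs) ≤_) (sym length-ys)
      (s≤s (length-mono-⊆-Unique uniq (λ z∈xs → remove (xs⊆ys (there z∈xs)) (All.lookup x∉xs z∈xs ∘ sym))))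
    where
    remove : ∀ {z} → z ∈ ys₁ ++ x ∷ ys₂ → z ≢ x → z ∈ ys₁ ++ ys₂
    remove z∈ z≢x with ∈-++⁻ ys₁ z∈
    ... | inj₁ z∈ys₁         = ∈-++⁺ˡ z∈ys₁
    ... | inj₂ (here z≡x)    = ⊥-elim (z≢x z≡x)
    ... | inj₂ (there z∈ys₂) = ∈-++⁺ʳ ys₁ z∈ys₂
    length-ys : length (ys₁ ++ x ∷ ys₂) ≡ suc (length (ys₁ ++ ys₂))
    length-ys = begin
      length (ys₁ ++ x ∷ ys₂)            ≡⟨ length-++ ys₁ ⟩
      length ys₁ ℕ.+ suc (length ys₂)    ≡⟨ ℕ.+-suc (length ys₁) (length ys₂) ⟩
      suc (length ys₁ ℕ.+ length ys₂)    ≡⟨ cong suc (sym (length-++ ys₁)) ⟩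
      suc (length (ys₁ ++ ys₂))          ∎
      where open ≡-Reasoning

  length-Unique-Fin : ∀ {n} {xs : List (Fin n)} → Unique xs → length xs ≤ n
  length-Unique-Fin {n} {xs} uniq =
    subst (length xs ≤_) (length-tabulate {n = n} (λ i → i)) (length-mono-⊆-Unique uniq (λ {x} _ → ∈-allFin x))

  length-filterᵇ : ∀ {A : Set} (p : A → Bool) xs → length (filterᵇ p xs) ≡ sum (map (λ x → if p x then 1 else 0) xs)
  length-filterᵇ p []       = refl
  length-filterᵇ p (x ∷ xs) with p x
  ... | true  = cong suc (length-filterᵇ p xs)
  ... | false = length-filterᵇ p xs

  module _ {n r : ℕ} (G : ColouredGraph n r) where
    open ColouredGraph G
    open import Data.List.Membership.DecPropositional (Fin._≟_ {n}) using (_∈?_)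

    private variable
      E : List (Fin n × Fin n)
      u v w : Fin n

    HEdge-sym : HEdge G E u v → HEdge G E v u
    HEdge-sym (inj₁ uv∈E) = inj₂ uv∈E
    HEdge-sym (inj₂ vu∈E) = inj₁ vu∈E

    HEdge-weaken : ∀ e → HEdge G E u v → HEdge G (e ∷ E) u v
    HEdge-weaken e (inj₁ uv∈E) = inj₁ (there uv∈E)
    HEdge-weaken e (inj₂ vu∈E) = inj₂ (there vu∈E)

    Walk-++ : Walk G E u v → Walk G E v w → Walk G E u w
    Walk-++ here          q = q
    Walk-++ (step edge p) q = step edge (Walk-++ p q)

    Walk-reverse : Walk G E u v → Walk G E v u
    Walk-reverse here          = here
    Walk-reverse (step edge p) = Walk-++ (Walk-reverse p) (step (HEdge-sym edge) here)

    Walk-weaken : ∀ e → Walk G E u v → Walk G (e ∷ E) u v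
    Walk-weaken e here          = here
    Walk-weaken e (step edge p) = step (HEdge-weaken e edge) (Walk-weaken e p)

    TwoNeighbours : List (Fin n × Fin n) → Fin n → Set
    TwoNeighbours E w = ∃₂ λ y z → y ≢ z × HEdge G E w y × HEdge G E w z

    -- The last hypothesis excludes the walk p y p, whose interior vertex y has only one neighbour.
    path-interior-twoNeighbours : ∀ p L q → Consecutive G E (p ∷ L ++ [ q ]) → Unique (p ∷ L) → q ∉ L →
                                  p ≢ q ⊎ 2 ≤ length L → w ∈ L → TwoNeighbours E w
    path-interior-twoNeighbours p (y ∷ []) q (py , yq , _) _ _ (inj₁ p≢q) (here refl) =
      p , q , p≢q , HEdge-sym py , yq
    path-interior-twoNeighbours p (y ∷ []) q _ _ _ (inj₂ (s≤s ())) (here refl)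
    path-interior-twoNeighbours p (y ∷ z ∷ L) q (py , yz , _) ((_ ∷ p≢z ∷ _) ∷ _) _ _ (here refl) =
      p , z , p≢z , HEdge-sym py , yz
    path-interior-twoNeighbours p (y ∷ L) q (_ , consec) (_ ∷ uniq) q∉yL _ (there w∈L) =
      path-interior-twoNeighbours y L q consec uniq (q∉yL ∘ there) (inj₁ (q∉yL ∘ here ∘ sym)) w∈L

    Consecutive-snoc : ∀ x L y z → Consecutive G E (x ∷ L ++ [ y ]) → HEdge G E y z →
                       Consecutive G E (x ∷ (L ++ [ y ]) ++ [ z ])
    Consecutive-snoc x []      y z (xy , _)     yz = xy , yz , tt
    Consecutive-snoc x (l ∷ L) y z (xl , consec) yz = xl , Consecutive-snoc l L y z consec yz

    cycle-twoNeighbours : ∀ x₀ xs xₗ → 2 ≤ length (xs ++ [ xₗ ]) → Unique (x₀ ∷ xs ++ [ xₗ ]) →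
                          Consecutive G E (x₀ ∷ xs ++ [ xₗ ]) → HEdge G E xₗ x₀ →
                          w ∈ x₀ ∷ xs ++ [ xₗ ] → TwoNeighbours E w
    cycle-twoNeighbours x₀ []       xₗ (s≤s ()) _ _ _ (here refl)
    cycle-twoNeighbours x₀ (y ∷ xs) xₗ _ (_ ∷ (y∉xs ∷ _)) (x₀y , _) xₗx₀ (here refl) =
      xₗ , y , (λ xₗ≡y → All.lookup y∉xs (∈-++⁺ʳ xs (here refl)) (sym xₗ≡y)) , HEdge-sym xₗx₀ , x₀y
    cycle-twoNeighbours x₀ xs xₗ long (x₀∉ ∷ uniq) consec xₗx₀ (there w∈) =
      path-interior-twoNeighbours x₀ (xs ++ [ xₗ ]) x₀ (Consecutive-snoc x₀ xs xₗ x₀ consec xₗx₀)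
        (x₀∉ ∷ uniq) (λ x₀∈ → All.lookup x₀∉ x₀∈ refl) (inj₂ long) w∈

    module _ {vs : List (Fin n)} (E-within : ∀ {x y} → (x , y) ∈ E → x ∈ vs × y ∈ vs)
             {a b : Fin n} (a∈vs : a ∈ vs) (b∉vs : b ∉ vs) where

      leaf-neighbour : HEdge G ((a , b) ∷ E) b w → w ≡ a
      leaf-neighbour (inj₁ (here refl)) = ⊥-elim (b∉vs a∈vs)
      leaf-neighbour (inj₁ (there bw∈)) = ⊥-elim (b∉vs (proj₁ (E-within bw∈)))
      leaf-neighbour (inj₂ (here refl)) = refl
      leaf-neighbour (inj₂ (there wb∈)) = ⊥-elim (b∉vs (proj₂ (E-within wb∈)))

      HEdge-strengthen : HEdge G ((a , b) ∷ E) u v → u ≢ b → v ≢ b → HEdge G E u v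
      HEdge-strengthen (inj₁ (here refl)) _   v≢b = ⊥-elim (v≢b refl)
      HEdge-strengthen (inj₁ (there uv∈)) _   _   = inj₁ uv∈
      HEdge-strengthen (inj₂ (here refl)) u≢b _   = ⊥-elim (u≢b refl)
      HEdge-strengthen (inj₂ (there vu∈)) _   _   = inj₂ vu∈

      Consecutive-strengthen : ∀ L → b ∉ L → Consecutive G ((a , b) ∷ E) L → Consecutive G E L
      Consecutive-strengthen []          _   _            = tt
      Consecutive-strengthen (x ∷ [])    _   _            = tt
      Consecutive-strengthen (x ∷ y ∷ L) b∉L (xy , consec) =
        HEdge-strengthen xy (b∉L ∘ here ∘ sym) (b∉L ∘ there ∘ here ∘ sym) ,
        Consecutive-strengthen (y ∷ L) (b∉L ∘ there) consec

      -- A vertex with a single neighbour lies on no cycle, so a cycle through the new edge is impossible.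
      acyclic-addLeaf : ¬ Cycle G E → ¬ Cycle G ((a , b) ∷ E)
      acyclic-addLeaf acyclic (x₀ , xs , xₗ , long , uniq , consec , xₗx₀) with b ∈? x₀ ∷ xs ++ [ xₗ ]
      ... | yes b∈cycle =
        let y , z , y≢z , by , bz = cycle-twoNeighbours x₀ xs xₗ long uniq consec xₗx₀ b∈cycle
        in  y≢z (trans (leaf-neighbour by) (sym (leaf-neighbour bz)))
      ... | no b∉cycle = acyclic (x₀ , xs , xₗ , long , uniq , Consecutive-strengthen _ b∉cycle consec ,
        HEdge-strengthen xₗx₀ (b∉cycle ∘ there ∘ ∈-++⁺ʳ xs ∘ here ∘ sym) (b∉cycle ∘ here ∘ sym))

    singletonTree : ∀ {c} → Fin n → MonoTree G c
    singletonTree v = record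
      { vs        = [ v ]
      ; es        = []
      ; nonempty  = s≤s z≤n
      ; distinct  = [] ∷ []
      ; edge-in-G = λ ()
      ; connected = λ { (here refl) (here refl) → here }
      ; acyclic   = λ { (_ , _ , _ , _ , _ , _ , inj₁ ()) ; (_ , _ , _ , _ , _ , _ , inj₂ ()) }
      }

    addLeaf : ∀ {c} (T : MonoTree G c) {a b} → a ∈ MonoTree.vs T → b ∉ MonoTree.vs T →
              adj a b ≡ true → colour a b ≡ c → MonoTree G c
    addLeaf {c} T {a} {b} a∈T b∉T ab≡true ab≡c = record
      { vs        = b ∷ vs
      ; es        = (a , b) ∷ es
      ; nonempty  = s≤s z≤n
      ; distinct  = ¬Any⇒All¬ vs b∉T ∷ distinct
      ; edge-in-G = edge-in-G′
      ; connected = connected′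
      ; acyclic   = acyclic-addLeaf (λ xy∈ → let x∈ , y∈ , _ = edge-in-G xy∈ in x∈ , y∈) a∈T b∉T acyclic
      }
      where
      open MonoTree T
      edge-in-G′ : ∀ {x y} → (x , y) ∈ (a , b) ∷ es → x ∈ b ∷ vs × y ∈ b ∷ vs × adj x y ≡ true × colour x y ≡ c
      edge-in-G′ (here refl) = there a∈T , here refl , ab≡true , ab≡c
      edge-in-G′ (there xy∈) = let x∈ , y∈ , xy≡true , xy≡c = edge-in-G xy∈ in there x∈ , there y∈ , xy≡true , xy≡c
      walk-to-leaf : ∀ {u} → u ∈ vs → Walk G ((a , b) ∷ es) u b
      walk-to-leaf u∈ = Walk-++ (Walk-weaken _ (connected u∈ a∈T)) (step (inj₁ (here refl)) here)
      connected′ : ∀ {u w} → u ∈ b ∷ vs → w ∈ b ∷ vs → Walk G ((a , b) ∷ es) u w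
      connected′ (here refl) (here refl) = here
      connected′ (here refl) (there w∈) = Walk-reverse (walk-to-leaf w∈)
      connected′ (there u∈) (here refl) = walk-to-leaf u∈
      connected′ (there u∈) (there w∈) = Walk-weaken _ (connected u∈ w∈)

    ColourClosed : Fin r → List (Fin n) → Set
    ColourClosed c S = ∀ {a b} → a ∈ S → adj a b ≡ true → colour a b ≡ c → b ∈ S

    ColourClosed-Walk : ∀ {c S} → ColourClosed c S → (∀ {x y} → (x , y) ∈ E → adj x y ≡ true × colour x y ≡ c) →
                        Walk G E u v → u ∈ S → v ∈ S
    ColourClosed-Walk closed E-coloured here u∈S = u∈S
    ColourClosed-Walk closed E-coloured (step (inj₁ uw∈) p) u∈S =
      let uw≡true , uw≡c = E-coloured uw∈ in ColourClosed-Walk closed E-coloured p (closed u∈S uw≡true uw≡c)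
    ColourClosed-Walk closed E-coloured (step {u} {w} (inj₂ wu∈) p) u∈S =
      let wu≡true , wu≡c = E-coloured wu∈
      in  ColourClosed-Walk closed E-coloured p (closed u∈S (trans (adj-sym u w) wu≡true) (trans (col-sym u w) wu≡c))

    LeavingEdge : Fin r → List (Fin n) → Set
    LeavingEdge c S = ∃₂ λ a b → a ∈ S × b ∉ S × adj a b ≡ true × colour a b ≡ c

    leavingEdge? : ∀ c S → Dec (LeavingEdge c S)
    leavingEdge? c S = Fin.any? λ a → Fin.any? λ b →
      a ∈? S ×-dec ¬? (b ∈? S) ×-dec adj a b Bool.≟ true ×-dec colour a b Fin.≟ c

    ¬LeavingEdge⇒ColourClosed : ∀ {c S} → ¬ LeavingEdge c S → ColourClosed c S
    ¬LeavingEdge⇒ColourClosed {S = S} none {a} {b} a∈S ab≡true ab≡c with b ∈? S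
    ... | yes b∈S = b∈S
    ... | no  b∉S = ⊥-elim (none (a , b , a∈S , b∉S , ab≡true , ab≡c))

    record ComponentTree (c : Fin r) (v : Fin n) : Set where
      field
        tree   : MonoTree G c
        root   : v ∈ MonoTree.vs tree
        closed : ColourClosed c (MonoTree.vs tree)

    growComponentTree : ∀ {c v} fuel (T : MonoTree G c) → v ∈ MonoTree.vs T →
                        n ≤ length (MonoTree.vs T) ℕ.+ fuel → ComponentTree c v
    growComponentTree {c} fuel T v∈T n≤ with leavingEdge? c (MonoTree.vs T)
    ... | no none = record { tree = T ; root = v∈T ; closed = ¬LeavingEdge⇒ColourClosed none }
    growComponentTree zero T v∈T n≤ | yes (_ , _ , a∈T , b∉T , ab≡true , ab≡c) =
      ⊥-elim (ℕ.<⇒≱ (length-Unique-Fin (MonoTree.distinct (addLeaf T a∈T b∉T ab≡true ab≡c)))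
                    (subst (n ≤_) (ℕ.+-identityʳ _) n≤))
    growComponentTree (suc fuel) T v∈T n≤ | yes (_ , _ , a∈T , b∉T , ab≡true , ab≡c) =
      growComponentTree fuel (addLeaf T a∈T b∉T ab≡true ab≡c) (there v∈T) (subst (n ≤_) (ℕ.+-suc _ fuel) n≤)

    componentTree : ∀ c v → ComponentTree c v
    componentTree c v = growComponentTree n (singletonTree v) (here refl) (ℕ.n≤1+n n)

    ComponentTree-overlap : ∀ {c v w x} (T : ComponentTree c v) (U : ComponentTree c w) →
                            x ∈ MonoTree.vs (ComponentTree.tree T) → x ∈ MonoTree.vs (ComponentTree.tree U) →
                            w ∈ MonoTree.vs (ComponentTree.tree T)
    ComponentTree-overlap {c} T U x∈T x∈U =
      ColourClosed-Walk (ComponentTree.closed T) coloured (connected x∈U (ComponentTree.root U)) x∈T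
      where
      open MonoTree (ComponentTree.tree U)
      coloured : ∀ {x y} → (x , y) ∈ es → adj x y ≡ true × colour x y ≡ c
      coloured xy∈ = let _ , _ , xy≡true , xy≡c = edge-in-G xy∈ in xy≡true , xy≡c

    component : Fin r → Fin n → List (Fin n)
    component c v = MonoTree.vs (ComponentTree.tree (componentTree c v))

    Covers : Fin n → Fin n → Set
    Covers v x = ∃ λ c → x ∈ component c v

    Covered : List (Fin n) → Fin n → Set
    Covered R x = Any (λ v → Covers v x) R

    covered? : ∀ R x → Dec (Covered R x)
    covered? R x = Any.any? (λ v → Fin.any? λ c → x ∈? component c v) R

    greedyRoots : List (Fin n) → List (Fin n) → List (Fin n)
    greedyRoots R []       = R
    greedyRoots R (x ∷ xs) with covered? R x
    ... | yes _ = greedyRoots R xs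
    ... | no  _ = greedyRoots (x ∷ R) xs

    greedyRoots-preserves : ∀ {P : Fin n → Set} xs R → Any P R → Any P (greedyRoots R xs)
    greedyRoots-preserves []       R p = p
    greedyRoots-preserves (x ∷ xs) R p with covered? R x
    ... | yes _ = greedyRoots-preserves xs R p
    ... | no  _ = greedyRoots-preserves xs (x ∷ R) (there p)

    greedyRoots-covers : Fin r → ∀ xs R {x} → x ∈ xs → Covered (greedyRoots R xs) x
    greedyRoots-covers c₀ (x ∷ xs) R (here refl) with covered? R x
    ... | yes covered = greedyRoots-preserves xs R covered
    ... | no  _       = greedyRoots-preserves xs (x ∷ R) (here (c₀ , ComponentTree.root (componentTree c₀ x)))
    greedyRoots-covers c₀ (y ∷ xs) R (there x∈xs) with covered? R y
    ... | yes _ = greedyRoots-covers c₀ xs R x∈xs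
    ... | no  _ = greedyRoots-covers c₀ xs (y ∷ R) x∈xs

    ComponentsDisjoint : Fin n → Fin n → Set
    ComponentsDisjoint v w = ∀ c → Disjoint (component c v) (component c w)

    greedyRoots-disjoint : ∀ xs R → AllPairs ComponentsDisjoint R → AllPairs ComponentsDisjoint (greedyRoots R xs)
    greedyRoots-disjoint []       R disjoint = disjoint
    greedyRoots-disjoint (x ∷ xs) R disjoint with covered? R x
    ... | yes _         = greedyRoots-disjoint xs R disjoint
    ... | no  uncovered = greedyRoots-disjoint xs (x ∷ R) (All.map separate (¬Any⇒All¬ R uncovered) ∷ disjoint)
      where
      separate : ∀ {w} → ¬ Covers w x → ComponentsDisjoint x w
      separate {w} x∉w c (y∈x , y∈w) = x∉w (c , ComponentTree-overlap (componentTree c w) (componentTree c x) y∈w y∈x)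

    -- Pairs (c, x) are encoded as combine c x : Fin (r * n), so a duplicate-free list of them has length ≤ r * n.
    componentCodes : Fin n → Fin r → List (Fin (r ℕ.* n))
    componentCodes v c = map (combine c) (component c v)

    rootCodes : Fin n → List (Fin (r ℕ.* n))
    rootCodes v = concatMap (componentCodes v) (allFin r)

    ∈-rootCodes⁺ : ∀ {c v x} → x ∈ component c v → combine c x ∈ rootCodes v
    ∈-rootCodes⁺ {c} {v} x∈ =
      ∈-concatMap⁺ (componentCodes v) (Any.map (λ { refl → ∈-map⁺ (combine c) x∈ }) (∈-allFin c))

    ∈-rootCodes⁻ : ∀ {v k} → k ∈ rootCodes v → ∃₂ λ c x → x ∈ component c v × k ≡ combine c x
    ∈-rootCodes⁻ {v} k∈ with c , _ , k∈c ← find (∈-concatMap⁻ (componentCodes v) {allFin r} k∈)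
      with x , x∈ , refl ← ∈-map⁻ (combine c) k∈c = c , x , x∈ , refl

    rootCodes-unique : ∀ v → Unique (rootCodes v)
    rootCodes-unique v =
      concat⁺ (All.map⁺ (All.tabulate⁺ componentCodes-unique)) (AllPairs.map⁺ (AllPairs.map separate (allFin⁺ r)))
      where
      componentCodes-unique : ∀ c → Unique (componentCodes v c)
      componentCodes-unique c = map⁺ (combine-injectiveʳ c _ c _) (MonoTree.distinct (ComponentTree.tree (componentTree c v)))
      separate : ∀ {c d} → c ≢ d → Disjoint (componentCodes v c) (componentCodes v d)
      separate {c} {d} c≢d (k∈c , k∈d)
        with _ , _ , refl ← ∈-map⁻ (combine c) k∈c | _ , _ , eq ← ∈-map⁻ (combine d) k∈d =
          c≢d (combine-injectiveˡ c _ d _ eq)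

    rootCodes-disjoint : ∀ {v w} → ComponentsDisjoint v w → Disjoint (rootCodes v) (rootCodes w)
    rootCodes-disjoint disjoint (k∈v , k∈w)
      with c , x , x∈v , refl ← ∈-rootCodes⁻ k∈v | d , y , y∈w , eq ← ∈-rootCodes⁻ k∈w
      with refl , refl ← combine-injective c x d y eq = disjoint c (x∈v , y∈w)

    coverCodes : List (Fin n) → List (Fin (r ℕ.* n))
    coverCodes R = concatMap rootCodes R

    coverCodes-unique : ∀ {R} → AllPairs ComponentsDisjoint R → Unique (coverCodes R)
    coverCodes-unique disjoint =
      concat⁺ (All.map⁺ (All.tabulate (λ {v} _ → rootCodes-unique v))) (AllPairs.map⁺ (AllPairs.map rootCodes-disjoint disjoint))

    neighbours : Fin n → List (Fin n)
    neighbours v = filterᵇ (adj v) (allFin n)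

    degree≤length-rootCodes : ∀ v → degree G v ≤ length (rootCodes v)
    degree≤length-rootCodes v =
      subst (_≤ length (rootCodes v)) (trans (length-map code (neighbours v)) (length-filterᵇ (adj v) (allFin n)))
        (length-mono-⊆-Unique (map⁺ code-injective (filter⁺ (T? ∘ adj v) {allFin n} (allFin⁺ n))) codes⊆rootCodes)
      where
      code : Fin n → Fin (r ℕ.* n)
      code u = combine (colour v u) u
      code-injective : ∀ {u w} → code u ≡ code w → u ≡ w
      code-injective {u} {w} = combine-injectiveʳ (colour v u) u (colour v w) w
      codes⊆rootCodes : ∀ {k} → k ∈ map code (neighbours v) → k ∈ rootCodes v
      codes⊆rootCodes k∈ with u , u∈ , refl ← ∈-map⁻ code k∈ =
        let open ComponentTree (componentTree (colour v u) v)
        in  ∈-rootCodes⁺ (closed root (Equivalence.to T-≡ (proj₂ (∈-filter⁻ (T? ∘ adj v) {xs = allFin n} u∈))) refl)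

    sum-degree≤length-coverCodes : ∀ R → sum (map (degree G) R) ≤ length (coverCodes R)
    sum-degree≤length-coverCodes []      = z≤n
    sum-degree≤length-coverCodes (v ∷ R) = subst (_ ≤_) (sym (length-++ (rootCodes v)))
      (ℕ.+-mono-≤ (degree≤length-rootCodes v) (sum-degree≤length-coverCodes R))

    componentTrees-cover : ∀ R → (∀ x → Covered R x) → TreeCover G (r ℕ.* length R)
    componentTrees-cover R covered = tree-at ∘ remQuot (length R) , covers
      where
      tree-at : Fin r × Fin (length R) → Σ (Fin r) (MonoTree G)
      tree-at (c , j) = c , ComponentTree.tree (componentTree c (lookup R j))
      covers : ∀ x → ∃ λ i → x ∈ MonoTree.vs (proj₂ (tree-at (remQuot (length R) i)))
      covers x =
        let c , x∈ = lookup-index (covered x)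
            j      = Any.index (covered x)
        in  combine c j , subst (λ p → x ∈ MonoTree.vs (proj₂ (tree-at p))) (sym (remQuot-combine c j)) x∈

open Arithmetic
open Components

open import Data.Nat using (ℕ; _≤_)
open import Data.Fin using (Fin)
open import Data.Product using (∃; _×_; _,_)
open import Data.Rational using (ℚ; ½; 1ℚ; _-_; _*_; _<_)
import Data.Rational as Q

import Data.Nat as ℕ
import Data.Nat.Properties as ℕ
import Data.Rational.Properties as ℚ
open import Data.Fin using (fromℕ<)
open import Data.List using (List; []; length; map; allFin)
open import Data.Nat.ListAction using (sum)
open import Data.List.Membership.Propositional.Properties using (∈-allFin)
open import Data.List.Relation.Unary.AllPairs using (AllPairs; [])
open import Relation.Binary.PropositionalEquality using (subst; sym)

disjointRoots-length-bound : ∀ {n r} (G : ColouredGraph n r) {x} R → AllPairs (ComponentsDisjoint G) R →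
                             (∀ v → x * fromℕ n Q.≤ fromℕ (degree G v)) → fromℕ (length R) * x Q.≤ fromℕ r
disjointRoots-length-bound {ℕ.zero} {r} G {x} [] _ _ =
  ℚ.≤-trans (ℚ.≤-reflexive (ℚ.*-zeroˡ x)) (fromℕ-mono-≤ (ℕ.z≤n {r}))
disjointRoots-length-bound {ℕ.suc n} {r} G {x} R disjoint minDegree = *-cancelʳ-fromℕ-suc {length R} {r} {n} (begin
  fromℕ (length R) * (x * fromℕ (ℕ.suc n))  ≤⟨ length*≤sum (degree G) minDegree R ⟩
  fromℕ (sum (map (degree G) R))            ≤⟨ fromℕ-mono-≤ (sum-degree≤length-coverCodes G R) ⟩
  fromℕ (length (coverCodes G R))           ≤⟨ fromℕ-mono-≤ (length-Unique-Fin (coverCodes-unique G disjoint)) ⟩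
  fromℕ (r ℕ.* ℕ.suc n)                     ∎)
  where open ℚ.≤-Reasoning

lemma3p9 : (r : ℕ) → 2 ≤ r → (δ : ℚ) → ½ Q.≤ δ → δ < 1ℚ →
    (n : ℕ) (G : ColouredGraph n r) →
    (∀ v → (1ℚ - δ) * fromℕ n Q.≤ fromℕ (degree G v)) →
    ∃ λ t → TreeCover G t × LeDivLogInv t (fromℕ (2 Data.Nat.* r Data.Nat.* r)) δ
lemma3p9 r 2≤r δ ½≤δ δ<1 n G minDegree = r ℕ.* length roots , cover , bound
  where
  roots : List (Fin n)
  roots = greedyRoots G [] (allFin n)
  cover : TreeCover G (r ℕ.* length roots)
  cover = componentTrees-cover G roots λ x → greedyRoots-covers G (fromℕ< 2≤r) (allFin n) [] (∈-allFin x)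
  rootsBound : fromℕ (length roots) * (1ℚ - δ) Q.≤ fromℕ r
  rootsBound = disjointRoots-length-bound G roots (greedyRoots-disjoint G (allFin n) [] []) minDegree
  bound : LeDivLogInv (r ℕ.* length roots) (fromℕ (2 ℕ.* r ℕ.* r)) δ
  bound = subst (λ m → LeDivLogInv (r ℕ.* length roots) (fromℕ m) δ) (sym (ℕ.*-assoc 2 r r))
                (LeDivLogInv-intro ½≤δ (ℚ.<⇒≤ δ<1) {r ℕ.* length roots} {r ℕ.* r} (*-scaleˡ-fromℕ r rootsBound))
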